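{- Let $t\ge1$ be an integer and let $t'$ be the integer obtained by reversing the binary expansion of $t$. Then $\gamma_t=\gamma_{t'}$; in particular $c_t=c_{t'}$.
   Context: $\mathsf s(n)$ denotes the number of ones in the binary expansion of $n\ge0$. For an integer $t\ge0$ and $j\in\mathbb Z$, $\mu_t(j)=\lim_{N\to\infty}\frac1N\#\{0\le n<N:\mathsf s(n+t)-\mathsf s(n)=j\}$ (these limits exist), $\gamma_t(\vartheta)=\sum_{j\in\mathbb Z}\mu_t(j)e^{ij\vartheta}$, and $c_t=\sum_{j\ge0}\mu_t(j)$. -}

module Defs where

open import Data.Bool using (Bool; true; false; if_then_else_)
open import Data.Nat using (ℕ; zero; suc; _+_; _*_; _≤_; _<_; _≡ᵇ_; ∣_-_∣)
open import Data.Nat.DivMod using (_/_; _%_)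
open import Data.Integer as ℤ using (ℤ; +_; _-_)
open import Data.List using (List; []; _∷_; reverse; foldr)
open import Data.Product using (∃)
open import Relation.Nullary using (does)

-- Binary digits of n, least significant first (no leading zeros; bits 0 = []).
-- The first argument is fuel; fuel n suffices since n has at most n digits.
bitsAux : ℕ → ℕ → List Bool
bitsAux zero    n = []
bitsAux (suc f) n = if n ≡ᵇ 0 then [] else ((n % 2 ≡ᵇ 1) ∷ bitsAux f (n / 2))

bits : ℕ → List Bool
bits n = bitsAux n n

fromBits : List Bool → ℕ
fromBits = foldr (λ b acc → (if b then 1 else 0) + 2 * acc) 0

countOnes : List Bool → ℕ
countOnes []          = 0
countOnes (true ∷ bs) = suc (countOnes bs)
countOnes (false ∷ bs) = countOnes bs

s : ℕ → ℕ
s n = countOnes (bits n)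

rev : ℕ → ℕ
rev t = fromBits (reverse (bits t))

δ : ℕ → ℕ → ℤ
δ t n = (+ s (n + t)) - (+ s n)

count : (ℕ → Bool) → ℕ → ℕ
count P zero    = 0
count P (suc N) = (if P N then 1 else 0) + count P N

isDiff : ℕ → ℤ → ℕ → Bool
isDiff t j n = does (δ t n ℤ.≟ j)

isNonneg : ℕ → ℕ → Bool
isNonneg t n = does (+ 0 ℤ.≤? δ t n)

-- (1/N)(#{n<N : P n} - #{n<N : Q n}) → 0 as N → ∞:
-- for every k there is N₀ with k·|count P N - count Q N| < N for all N ≥ N₀.
-- Since the densities of P and Q exist, this says exactly that they are equal.
SameDensity : (ℕ → Bool) → (ℕ → Bool) → Set
SameDensity P Q = ∀ (k : ℕ) → ∃ λ N₀ → ∀ (N : ℕ) → N₀ ≤ N →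
  suc k * ∣ count P N - count Q N ∣ < N

module Submission where

open import Defs
open import Data.Nat using (ℕ; _≤_)
open import Data.Integer using (ℤ)
open import Data.Product using (_×_; _,_)
import Data.Integer as ℤ

-- Let F t j N (atLeast) count the n < N with s(n + t) − s(n) ≥ j. Splitting n by parity gives
-- F (2t) j (2N) = 2 F t j N and F (2t+1) j (2N) = F t (j−1) N + F (t+1) (j+1) N, so the pair
-- (F t, F (t+1)) at 2^L N is obtained from (F 0, F 1) at N by multiplying with one 2×2 matrix M₀ or M₁
-- of shift operators per binary digit of t. The pair (F 0, F 1) lies within 1 of a vector seed f, and
-- for such vectors the first coordinate of M_w (seed f) is unchanged when the word w is reversed:
-- a symmetric Q satisfies Q Mᵦ = Mᵦᵀ Q, the pairing of seed against Q v is 2Δ² of the first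
-- coordinate of v, and Q (seed f) = (2Δ² f, 0); transposing M_w reverses w, and 2Δ² can be removed
-- since it is onto and commutes with everything in sight. So F t − F t′ stays bounded as N grows,
-- and a bounded difference of counts has density zero.

module ShiftOperators where
  open import Data.Bool using (Bool; true; false)
  open import Data.Nat as ℕ using (zero)
  import Data.Nat.Properties as ℕ
  open import Data.Integer using (+_; -[1+_]; _+_; _*_; _-_; ∣_∣; 0ℤ; suc; pred)
  open import Data.Integer.Properties
    using (suc-pred; pred-suc; ∣i+j∣≤∣i∣+∣j∣; +-assoc; +-comm; +-inverseʳ; +-identityʳ; *-cancelˡ-≡)
  open import Data.Integer.Tactic.RingSolver using (solve-∀)
  open import Data.List using (List; []; _∷_; _++_; reverse; [_]; length)
  open import Data.List.Properties using (unfold-reverse)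
  open import Data.Product using (Σ; proj₁; proj₂)
  open import Function using (_∘_)
  open import Relation.Binary.PropositionalEquality hiding ([_])
  import Relation.Binary.Reasoning.Setoid as SetoidReasoning

  Seq : Set
  Seq = ℤ → ℤ

  Pair : Set
  Pair = Seq × Seq

  infixl 6 _⊕_ _⊖_

  _⊕_ _⊖_ : Seq → Seq → Seq
  (f ⊕ g) j = f j + g j
  (f ⊖ g) j = f j - g j

  twice : Seq → Seq
  twice f = f ⊕ f

  S⁻ S⁺ : Seq → Seq
  S⁻ f j = f (pred j)
  S⁺ f j = f (suc j)

  0ˢ : Seq
  0ˢ _ = 0ℤ

  Δ² : Seq → Seq
  Δ² f = S⁻ f ⊕ S⁺ f ⊖ twice f

  S⁻-S⁺ : ∀ f → S⁻ (S⁺ f) ≗ f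
  S⁻-S⁺ f j = cong f (suc-pred j)

  S⁺-S⁻ : ∀ f → S⁺ (S⁻ f) ≗ f
  S⁺-S⁻ f j = cong f (pred-suc j)

  twice-injective : ∀ {f g} → twice f ≗ twice g → f ≗ g
  twice-injective {f} {g} eq j =
    *-cancelˡ-≡ (+ 2) (f j) (g j) (trans (double (f j)) (trans (eq j) (sym (double (g j)))))
    where
    double : ∀ x → + 2 * x ≡ x + x
    double = solve-∀

  -- Such operators commute with every entry of the matrices below (polynomials in S⁻, S⁺),
  -- which is what makes transposition work in stepᵀ-adjoint.
  record IsShiftHom (φ : Seq → Seq) : Set where
    field
      cong-≗ : ∀ {f g} → f ≗ g → φ f ≗ φ g
      ⊕-homo : ∀ f g → φ (f ⊕ g) ≗ φ f ⊕ φ g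
      S⁺-comm : ∀ f → φ (S⁺ f) ≗ S⁺ (φ f)

    S⁻-comm : ∀ f → φ (S⁻ f) ≗ S⁻ (φ f)
    S⁻-comm f j = trans (sym (S⁻-S⁺ (φ (S⁻ f)) j))
                        (trans (sym (S⁺-comm (S⁻ f) (pred j))) (cong-≗ (S⁺-S⁻ f) (pred j)))

    ⊖-homo : ∀ f g → φ (f ⊖ g) ≗ φ f ⊖ φ g
    ⊖-homo f g j = trans (x≡[x+y]-y (φ (f ⊖ g) j) (φ g j))
                         (cong (_- φ g j) (trans (sym (⊕-homo (f ⊖ g) g j)) (cong-≗ cancel j)))
      where
      x≡[x+y]-y : ∀ x y → x ≡ (x + y) - y
      x≡[x+y]-y = solve-∀
      [x-y]+y≡x : ∀ x y → (x - y) + y ≡ x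
      [x-y]+y≡x = solve-∀
      cancel : f ⊖ g ⊕ g ≗ f
      cancel i = [x-y]+y≡x (f i) (g i)

    0-homo : φ 0ˢ ≗ 0ˢ
    0-homo j = trans (⊖-homo 0ˢ 0ˢ j) (+-inverseʳ (φ 0ˢ j))

    Δ²-comm : ∀ f → φ (Δ² f) ≗ Δ² (φ f)
    Δ²-comm f j = trans (⊖-homo (S⁻ f ⊕ S⁺ f) (twice f) j)
      (cong₂ _-_ (trans (⊕-homo (S⁻ f) (S⁺ f) j) (cong₂ _+_ (S⁻-comm f j) (S⁺-comm f j)))
                 (⊕-homo f f j))

  open IsShiftHom

  id-hom : IsShiftHom (λ f → f)
  id-hom = record { cong-≗ = λ eq → eq ; ⊕-homo = λ f g j → refl ; S⁺-comm = λ f j → refl }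

  ⊕-hom : ∀ {φ ψ} → IsShiftHom φ → IsShiftHom ψ → IsShiftHom (λ f → φ f ⊕ ψ f)
  ⊕-hom {φ} {ψ} hφ hψ = record
    { cong-≗ = λ eq j → cong₂ _+_ (cong-≗ hφ eq j) (cong-≗ hψ eq j)
    ; ⊕-homo = λ f g j → trans (cong₂ _+_ (⊕-homo hφ f g j) (⊕-homo hψ f g j))
                               (interchange (φ f j) (φ g j) (ψ f j) (ψ g j))
    ; S⁺-comm = λ f j → cong₂ _+_ (S⁺-comm hφ f j) (S⁺-comm hψ f j) }
    where
    interchange : ∀ a b c d → (a + b) + (c + d) ≡ (a + c) + (b + d)
    interchange = solve-∀

  ⊖-hom : ∀ {φ ψ} → IsShiftHom φ → IsShiftHom ψ → IsShiftHom (λ f → φ f ⊖ ψ f)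
  ⊖-hom {φ} {ψ} hφ hψ = record
    { cong-≗ = λ eq j → cong₂ _-_ (cong-≗ hφ eq j) (cong-≗ hψ eq j)
    ; ⊕-homo = λ f g j → trans (cong₂ _-_ (⊕-homo hφ f g j) (⊕-homo hψ f g j))
                               (interchange (φ f j) (φ g j) (ψ f j) (ψ g j))
    ; S⁺-comm = λ f j → cong₂ _-_ (S⁺-comm hφ f j) (S⁺-comm hψ f j) }
    where
    interchange : ∀ a b c d → (a + b) - (c + d) ≡ (a - c) + (b - d)
    interchange = solve-∀

  twice-hom : ∀ {φ} → IsShiftHom φ → IsShiftHom (twice ∘ φ)
  twice-hom hφ = ⊕-hom hφ hφ

  S⁺-hom : ∀ {φ} → IsShiftHom φ → IsShiftHom (S⁺ ∘ φ)
  S⁺-hom hφ = record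
    { cong-≗ = λ eq j → cong-≗ hφ eq (suc j)
    ; ⊕-homo = λ f g j → ⊕-homo hφ f g (suc j)
    ; S⁺-comm = λ f j → S⁺-comm hφ f (suc j) }

  S⁻-hom : ∀ {φ} → IsShiftHom φ → IsShiftHom (S⁻ ∘ φ)
  S⁻-hom {φ} hφ = record
    { cong-≗ = λ eq j → cong-≗ hφ eq (pred j)
    ; ⊕-homo = λ f g j → ⊕-homo hφ f g (pred j)
    ; S⁺-comm = λ f j → trans (S⁺-comm hφ f (pred j))
                              (cong (φ f) (trans (suc-pred j) (sym (pred-suc j)))) }

  infix 4 _≈_
  _≈_ : Pair → Pair → Set
  v ≈ w = (proj₁ v ≗ proj₁ w) × (proj₂ v ≗ proj₂ w)

  ≈-refl : ∀ {v} → v ≈ v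
  ≈-refl = (λ _ → refl) , (λ _ → refl)

  ≈-trans : ∀ {u v w} → u ≈ v → v ≈ w → u ≈ w
  ≈-trans (p , q) (p′ , q′) = (λ j → trans (p j) (p′ j)) , (λ j → trans (q j) (q′ j))

  step : Bool → Pair → Pair
  step false (a , b) = twice a , S⁻ a ⊕ S⁺ b
  step true  (a , b) = S⁻ a ⊕ S⁺ b , twice b

  stepᵀ : Bool → Pair → Pair
  stepᵀ false (a , b) = twice a ⊕ S⁻ b , S⁺ b
  stepᵀ true  (a , b) = S⁻ a , S⁺ a ⊕ twice b

  steps stepsᵀ : List Bool → Pair → Pair
  steps  []      v = v
  steps  (b ∷ l) v = step b (steps l v)
  stepsᵀ []      v = v
  stepsᵀ (b ∷ l) v = stepᵀ b (stepsᵀ l v)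

  step-cong : ∀ b {v w} → v ≈ w → step b v ≈ step b w
  step-cong false (p , q) = (λ j → cong₂ _+_ (p j) (p j)) , (λ j → cong₂ _+_ (p _) (q _))
  step-cong true  (p , q) = (λ j → cong₂ _+_ (p _) (q _)) , (λ j → cong₂ _+_ (q j) (q j))

  stepᵀ-cong : ∀ b {v w} → v ≈ w → stepᵀ b v ≈ stepᵀ b w
  stepᵀ-cong false (p , q) = (λ j → cong₂ _+_ (cong₂ _+_ (p j) (p j)) (q _)) , (λ j → q _)
  stepᵀ-cong true  (p , q) = (λ j → p _) , (λ j → cong₂ _+_ (p _) (cong₂ _+_ (q j) (q j)))

  stepsᵀ-cong : ∀ l {v w} → v ≈ w → stepsᵀ l v ≈ stepsᵀ l w
  stepsᵀ-cong []      e = e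
  stepsᵀ-cong (b ∷ l) e = stepᵀ-cong b (stepsᵀ-cong l e)

  steps-++ : ∀ l l′ v → steps (l ++ l′) v ≡ steps l (steps l′ v)
  steps-++ []      l′ v = refl
  steps-++ (b ∷ l) l′ v = cong (step b) (steps-++ l l′ v)

  -- The symmetric matrix  ((S⁻ − 1)² − 1 , 1 ; 1 , (S⁺ − 1)² − 1).
  Q : Pair → Pair
  Q (a , b) = S⁻ (S⁻ a) ⊖ twice (S⁻ a) ⊕ b , a ⊕ S⁺ (S⁺ b) ⊖ twice (S⁺ b)

  Q-step : ∀ b v → Q (step b v) ≈ stepᵀ b (Q v)
  Q-step false (a , b) = first , second
    where
    first : ∀ j → proj₁ (Q (step false (a , b))) j ≡ proj₁ (stepᵀ false (Q (a , b))) j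
    first j rewrite suc-pred j = ring (a (pred (pred j))) (a (pred j)) (b j) (b (suc j))
      where
      ring : ∀ A B C D → ((A + A) - ((B + B) + (B + B))) + (B + D)
                       ≡ ((A - (B + B)) + C) + ((A - (B + B)) + C) + ((B + D) - (C + C))
      ring = solve-∀
    second : ∀ j → proj₂ (Q (step false (a , b))) j ≡ proj₂ (stepᵀ false (Q (a , b))) j
    second j rewrite pred-suc (suc j) | pred-suc j =
      ring (a j) (a (suc j)) (b (suc (suc j))) (b (suc (suc (suc j))))
      where
      ring : ∀ A B C D → ((A + A) + (B + D)) - ((A + C) + (A + C)) ≡ (B + D) - (C + C)
      ring = solve-∀
  Q-step true (a , b) = first , second
    where
    first : ∀ j → proj₁ (Q (step true (a , b))) j ≡ proj₁ (stepᵀ true (Q (a , b))) j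
    first j rewrite suc-pred (pred j) | suc-pred j =
      ring (a (pred (pred (pred j)))) (a (pred (pred j))) (b (pred j)) (b j)
      where
      ring : ∀ A B C D → ((A + C) - ((B + D) + (B + D))) + (D + D) ≡ (A - (B + B)) + C
      ring = solve-∀
    second : ∀ j → proj₂ (Q (step true (a , b))) j ≡ proj₂ (stepᵀ true (Q (a , b))) j
    second j rewrite pred-suc j = ring (a (pred j)) (a j) (b (suc j)) (b (suc (suc j)))
      where
      ring : ∀ A B C D → ((A + C) + (D + D)) - ((C + C) + (C + C))
                       ≡ ((A - (B + B)) + C) + (((B + D) - (C + C)) + ((B + D) - (C + C)))
      ring = solve-∀

  Q-steps : ∀ l v → Q (steps l v) ≈ stepsᵀ l (Q v)
  Q-steps []      v = ≈-refl
  Q-steps (b ∷ l) v = ≈-trans (Q-step b (steps l v)) (stepᵀ-cong b (Q-steps l v))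

  IsPairHom : (Seq → Pair) → Set
  IsPairHom α = IsShiftHom (proj₁ ∘ α) × IsShiftHom (proj₂ ∘ α)

  step-hom : ∀ b {α} → IsPairHom α → IsPairHom (step b ∘ α)
  step-hom false (h₁ , h₂) = twice-hom h₁ , ⊕-hom (S⁻-hom h₁) (S⁺-hom h₂)
  step-hom true  (h₁ , h₂) = ⊕-hom (S⁻-hom h₁) (S⁺-hom h₂) , twice-hom h₂

  steps-hom : ∀ l {α} → IsPairHom α → IsPairHom (steps l ∘ α)
  steps-hom []      hα = hα
  steps-hom (b ∷ l) hα = step-hom b (steps-hom l hα)

  ⟨_∣_⟩ : (Seq → Pair) → Pair → Seq
  ⟨ α ∣ (a , b) ⟩ = proj₁ (α a) ⊕ proj₂ (α b)

  ⟨⟩-cong : ∀ {α} → IsPairHom α → ∀ {v w} → v ≈ w → ⟨ α ∣ v ⟩ ≗ ⟨ α ∣ w ⟩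
  ⟨⟩-cong (h₁ , h₂) (p , q) j = cong₂ _+_ (cong-≗ h₁ p j) (cong-≗ h₂ q j)

  stepᵀ-adjoint : ∀ b {α} → IsPairHom α → ∀ v → ⟨ α ∣ stepᵀ b v ⟩ ≗ ⟨ step b ∘ α ∣ v ⟩
  stepᵀ-adjoint false {α} (h₁ , h₂) (a , b) j =
    trans (cong₂ _+_ (trans (⊕-homo h₁ (twice a) (S⁻ b) j)
                            (cong₂ _+_ (⊕-homo h₁ a a j) (S⁻-comm h₁ b j)))
                     (S⁺-comm h₂ b j))
          (+-assoc (twice (proj₁ (α a)) j) (proj₁ (α b) (pred j)) (proj₂ (α b) (suc j)))
  stepᵀ-adjoint true {α} (h₁ , h₂) (a , b) j =
    trans (cong₂ _+_ (S⁻-comm h₁ a j)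
                     (trans (⊕-homo h₂ (S⁺ a) (twice b) j)
                            (cong₂ _+_ (S⁺-comm h₂ a j) (⊕-homo h₂ b b j))))
          (sym (+-assoc (proj₁ (α a) (pred j)) (proj₂ (α a) (suc j)) (twice (proj₂ (α b)) j)))

  stepsᵀ-adjoint : ∀ l {α} → IsPairHom α → ∀ v → ⟨ α ∣ stepsᵀ l v ⟩ ≗ ⟨ steps (reverse l) ∘ α ∣ v ⟩
  stepsᵀ-adjoint []      hα v j = refl
  stepsᵀ-adjoint (b ∷ l) {α} hα (a₀ , b₀) j =
    trans (stepᵀ-adjoint b hα (stepsᵀ l (a₀ , b₀)) j)
          (trans (stepsᵀ-adjoint l (step-hom b hα) (a₀ , b₀) j)
                 (cong₂ (λ u w → proj₁ u j + proj₂ w j) (reversal a₀) (reversal b₀)))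
    where
    reversal : ∀ h → steps (reverse l) (step b (α h)) ≡ steps (reverse (b ∷ l)) (α h)
    reversal h rewrite unfold-reverse b l = sym (steps-++ (reverse l) [ b ] (α h))

  seed : Seq → Pair
  seed f = twice (S⁺ f) ⊖ S⁺ (S⁺ f) , f

  seed-hom : IsPairHom seed
  seed-hom = ⊖-hom (twice-hom (S⁺-hom id-hom)) (S⁺-hom (S⁺-hom id-hom)) , id-hom

  Q-seed : ∀ f → Q (seed f) ≈ (twice (Δ² f) , 0ˢ)
  Q-seed f = first , second
    where
    first : ∀ j → proj₁ (Q (seed f)) j ≡ twice (Δ² f) j
    first j rewrite suc-pred (pred j) | suc-pred j = ring (f (pred j)) (f j) (f (suc j))
      where
      ring : ∀ A B C → (((A + A) - B) - (((B + B) - C) + ((B + B) - C))) + B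
                     ≡ ((A + C) - (B + B)) + ((A + C) - (B + B))
      ring = solve-∀
    second : ∀ j → proj₂ (Q (seed f)) j ≡ 0ℤ
    second j = ring (f (suc j)) (f (suc (suc j)))
      where
      ring : ∀ A B → (((A + A) - B) + B) - (A + A) ≡ 0ℤ
      ring = solve-∀

  ⟨seed∣Q⟩ : ∀ v → ⟨ seed ∣ Q v ⟩ ≗ twice (Δ² (proj₁ v))
  ⟨seed∣Q⟩ (a , b) j rewrite pred-suc (suc j) | pred-suc j =
    ring (a (pred j)) (a j) (a (suc j)) (b (suc j)) (b (suc (suc j)))
    where
    ring : ∀ A B C D E → (((((A - (B + B)) + D) + ((A - (B + B)) + D))
                           - ((B - (C + C)) + E)) + ((B + E) - (D + D)))
                       ≡ ((A + C) - (B + B)) + ((A + C) - (B + B))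
    ring = solve-∀

  linearRecurrence : (ℕ → ℤ) → ℤ → ℤ → ℕ → ℤ
  linearRecurrence c x y zero    = x
  linearRecurrence c x y (ℕ.suc n) = linearRecurrence (c ∘ ℕ.suc) y (c 0 + (y + y) - x) n

  linearRecurrence-step : ∀ c x y n →
    let u = linearRecurrence c x y in u (ℕ.suc (ℕ.suc n)) ≡ c n + (u (ℕ.suc n) + u (ℕ.suc n)) - u n
  linearRecurrence-step c x y zero    = refl
  linearRecurrence-step c x y (ℕ.suc n) = linearRecurrence-step (c ∘ ℕ.suc) y (c 0 + (y + y) - x) n

  Δ²-surjective : ∀ g → Σ Seq λ h → Δ² h ≗ g
  Δ²-surjective g = h , Δ²h≗g
    where
    forward backward : ℕ → ℤ
    forward  = linearRecurrence (λ n → g (+ ℕ.suc n)) 0ℤ 0ℤ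
    backward = linearRecurrence (λ n → g -[1+ n ]) 0ℤ (g 0ℤ)

    h : Seq
    h (+ n)    = forward n
    h -[1+ n ] = backward (ℕ.suc n)

    h-suc-negative : ∀ n → h (suc -[1+ n ]) ≡ backward n
    h-suc-negative zero      = refl
    h-suc-negative (ℕ.suc n) = refl

    second-difference : ∀ c u₀ u₁ u₂ → u₂ ≡ c + (u₁ + u₁) - u₀ → (u₀ + u₂) - (u₁ + u₁) ≡ c
    second-difference c u₀ u₁ u₂ refl = ring c u₀ u₁
      where
      ring : ∀ c u₀ u₁ → (u₀ + (c + (u₁ + u₁) - u₀)) - (u₁ + u₁) ≡ c
      ring = solve-∀

    Δ²h≗g : Δ² h ≗ g
    Δ²h≗g (+ zero)    = ring (g 0ℤ)
      where
      ring : ∀ x → (x + 0ℤ) - (0ℤ + 0ℤ) ≡ x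
      ring = solve-∀
    Δ²h≗g (+ ℕ.suc n) =
      second-difference _ (forward n) (forward (ℕ.suc n)) _ (linearRecurrence-step (λ n → g (+ ℕ.suc n)) 0ℤ 0ℤ n)
    Δ²h≗g -[1+ n ]    = begin
      (b₂ + h (suc -[1+ n ])) - (b₁ + b₁)  ≡⟨ cong (λ y → (b₂ + y) - (b₁ + b₁)) (h-suc-negative n) ⟩
      (b₂ + backward n) - (b₁ + b₁)        ≡⟨ cong (_- (b₁ + b₁)) (+-comm b₂ (backward n)) ⟩
      (backward n + b₂) - (b₁ + b₁)        ≡⟨ second-difference _ (backward n) b₁ b₂
                                                (linearRecurrence-step (λ n → g -[1+ n ]) 0ℤ (g 0ℤ) n) ⟩
      g -[1+ n ]                           ∎
      where
      open ≡-Reasoning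
      b₁ = backward (ℕ.suc n)
      b₂ = backward (ℕ.suc (ℕ.suc n))

  ⟦_⟧ : List Bool → Seq → Seq
  ⟦ l ⟧ f = proj₁ (steps l (seed f))

  ⟦⟧-hom : ∀ l → IsShiftHom ⟦ l ⟧
  ⟦⟧-hom l = proj₁ (steps-hom l seed-hom)

  twice-Δ²-⟦⟧ : ∀ l f → twice (Δ² (⟦ l ⟧ f)) ≗ ⟦ reverse l ⟧ (twice (Δ² f))
  twice-Δ²-⟦⟧ l f j = begin
    twice (Δ² (⟦ l ⟧ f)) j                                 ≡⟨ ⟨seed∣Q⟩ (steps l (seed f)) j ⟨
    ⟨ seed ∣ Q (steps l (seed f)) ⟩ j                      ≡⟨ ⟨⟩-cong seed-hom (Q-steps l (seed f)) j ⟩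
    ⟨ seed ∣ stepsᵀ l (Q (seed f)) ⟩ j                     ≡⟨ ⟨⟩-cong seed-hom (stepsᵀ-cong l (Q-seed f)) j ⟩
    ⟨ seed ∣ stepsᵀ l (twice (Δ² f) , 0ˢ) ⟩ j              ≡⟨ stepsᵀ-adjoint l seed-hom _ j ⟩
    ⟦ reverse l ⟧ (twice (Δ² f)) j + proj₂ (steps (reverse l) (seed 0ˢ)) j
      ≡⟨ cong (λ x → ⟦ reverse l ⟧ (twice (Δ² f)) j + x) (0-homo (proj₂ (steps-hom (reverse l) seed-hom)) j) ⟩
    ⟦ reverse l ⟧ (twice (Δ² f)) j + 0ℤ                    ≡⟨ +-identityʳ _ ⟩
    ⟦ reverse l ⟧ (twice (Δ² f)) j                         ∎
    where open ≡-Reasoning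

  ⟦⟧-reverse : ∀ l g → ⟦ l ⟧ g ≗ ⟦ reverse l ⟧ g
  ⟦⟧-reverse l g = begin
    ⟦ l ⟧ g                 ≈⟨ cong-≗ φ-hom (λ i → sym (Δ²h≗g i)) ⟩
    ⟦ l ⟧ (Δ² h)            ≈⟨ Δ²-comm φ-hom h ⟩
    Δ² (⟦ l ⟧ h)            ≈⟨ twice-injective twice-Δ²-reversed ⟩
    Δ² (⟦ reverse l ⟧ h)    ≈⟨ Δ²-comm ψ-hom h ⟨
    ⟦ reverse l ⟧ (Δ² h)    ≈⟨ cong-≗ ψ-hom Δ²h≗g ⟩
    ⟦ reverse l ⟧ g         ∎
    where
    open SetoidReasoning (ℤ →-setoid ℤ)
    h = proj₁ (Δ²-surjective g)
    Δ²h≗g = proj₂ (Δ²-surjective g)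
    φ-hom = ⟦⟧-hom l
    ψ-hom = ⟦⟧-hom (reverse l)
    twice-Δ²-reversed : twice (Δ² (⟦ l ⟧ h)) ≗ twice (Δ² (⟦ reverse l ⟧ h))
    twice-Δ²-reversed = begin
      twice (Δ² (⟦ l ⟧ h))            ≈⟨ twice-Δ²-⟦⟧ l h ⟩
      ⟦ reverse l ⟧ (twice (Δ² h))    ≈⟨ ⊕-homo ψ-hom (Δ² h) (Δ² h) ⟩
      twice (⟦ reverse l ⟧ (Δ² h))    ≈⟨ (λ i → cong₂ _+_ (Δ²-comm ψ-hom h i) (Δ²-comm ψ-hom h i)) ⟩
      twice (Δ² (⟦ reverse l ⟧ h))    ∎

  Near : ℕ → Pair → Pair → Set
  Near e v w = (∀ j → ∣ proj₁ v j - proj₁ w j ∣ ℕ.≤ e) × (∀ j → ∣ proj₂ v j - proj₂ w j ∣ ℕ.≤ e)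

  sum-near : ∀ {e} x y x′ y′ → ∣ x - x′ ∣ ℕ.≤ e → ∣ y - y′ ∣ ℕ.≤ e → ∣ (x + y) - (x′ + y′) ∣ ℕ.≤ 2 ℕ.* e
  sum-near {e} x y x′ y′ x≈x′ y≈y′ = begin
    ∣ (x + y) - (x′ + y′) ∣      ≡⟨ cong ∣_∣ (interchange x y x′ y′) ⟩
    ∣ (x - x′) + (y - y′) ∣      ≤⟨ ∣i+j∣≤∣i∣+∣j∣ (x - x′) (y - y′) ⟩
    ∣ x - x′ ∣ ℕ.+ ∣ y - y′ ∣    ≤⟨ ℕ.+-mono-≤ x≈x′ y≈y′ ⟩
    e ℕ.+ e                      ≡⟨ cong (e ℕ.+_) (ℕ.+-identityʳ e) ⟨
    2 ℕ.* e                      ∎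
    where
    open ℕ.≤-Reasoning
    interchange : ∀ x y x′ y′ → (x + y) - (x′ + y′) ≡ (x - x′) + (y - y′)
    interchange = solve-∀

  Near-step : ∀ b {e v w} → Near e v w → Near (2 ℕ.* e) (step b v) (step b w)
  Near-step false {v = a , b} {a′ , b′} (p , q) =
    (λ j → sum-near (a j) (a j) (a′ j) (a′ j) (p j) (p j)) ,
    (λ j → sum-near (a (pred j)) (b (suc j)) (a′ (pred j)) (b′ (suc j)) (p _) (q _))
  Near-step true  {v = a , b} {a′ , b′} (p , q) =
    (λ j → sum-near (a (pred j)) (b (suc j)) (a′ (pred j)) (b′ (suc j)) (p _) (q _)) ,
    (λ j → sum-near (b j) (b j) (b′ j) (b′ j) (q j) (q j))

  Near-steps : ∀ l {e v w} → Near e v w → Near (2 ℕ.^ length l ℕ.* e) (steps l v) (steps l w)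
  Near-steps []      {e} (p , q) = (λ j → subst (_ ℕ.≤_) (sym (ℕ.+-identityʳ e)) (p j)) ,
                                   (λ j → subst (_ ℕ.≤_) (sym (ℕ.+-identityʳ e)) (q j))
  Near-steps (b ∷ l) {e} near rewrite ℕ.*-assoc 2 (2 ℕ.^ length l) e = Near-step b (Near-steps l near)

module BinaryDigits where
  open import Data.Bool using (if_then_else_)
  open import Data.Nat
  open import Data.Nat.Properties
  open import Data.Nat.DivMod
  open import Data.List using (_∷_)
  open import Relation.Binary.PropositionalEquality

  [1+n]/2≤n : ∀ n → suc n / 2 ≤ n
  [1+n]/2≤n n = s≤s⁻¹ (m/n<m (suc n) 2 (s≤s (s≤s z≤n)))

  bitsAux-fuel : ∀ f g n → n ≤ f → n ≤ g → bitsAux f n ≡ bitsAux g n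
  bitsAux-fuel zero    zero    n       _  _  = refl
  bitsAux-fuel zero    (suc g) zero    _  _  = refl
  bitsAux-fuel (suc f) zero    zero    _  _  = refl
  bitsAux-fuel (suc f) (suc g) zero    _  _  = refl
  bitsAux-fuel (suc f) (suc g) (suc n) n<f n<g =
    cong (_ ∷_) (bitsAux-fuel f g (suc n / 2) (≤-trans ([1+n]/2≤n n) (s≤s⁻¹ n<f))
                                             (≤-trans ([1+n]/2≤n n) (s≤s⁻¹ n<g)))

  bits-nonZero : ∀ n .{{_ : NonZero n}} → bits n ≡ (n % 2 ≡ᵇ 1) ∷ bits (n / 2)
  bits-nonZero (suc n) =
    cong ((suc n % 2 ≡ᵇ 1) ∷_) (bitsAux-fuel n (suc n / 2) (suc n / 2) ([1+n]/2≤n n) ≤-refl)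

  [2n]%2≡0 : ∀ n → 2 * n % 2 ≡ 0
  [2n]%2≡0 n = trans (cong (_% 2) (*-comm 2 n)) (m*n%n≡0 n 2)

  [2n]/2≡n : ∀ n → 2 * n / 2 ≡ n
  [2n]/2≡n n = trans (cong (_/ 2) (*-comm 2 n)) (m*n/n≡m n 2)

  [1+2n]%2≡1 : ∀ n → suc (2 * n) % 2 ≡ 1
  [1+2n]%2≡1 n = trans (cong (λ m → suc m % 2) (*-comm 2 n)) ([m+kn]%n≡m%n 1 n 2)

  [1+2n]/2≡n : ∀ n → suc (2 * n) / 2 ≡ n
  [1+2n]/2≡n n = begin
    (1 + 2 * n) / 2      ≡⟨ +-distrib-/ 1 (2 * n) (subst (λ r → 1 + r < 2) (sym ([2n]%2≡0 n)) ≤-refl) ⟩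
    1 / 2 + 2 * n / 2    ≡⟨ [2n]/2≡n n ⟩
    n                    ∎
    where open ≡-Reasoning

  s[2n]≡s[n] : ∀ n → s (2 * n) ≡ s n
  s[2n]≡s[n] zero      = refl
  s[2n]≡s[n] n@(suc _) = begin
    countOnes (bits (2 * n))
      ≡⟨ cong countOnes (bits-nonZero (2 * n)) ⟩
    countOnes ((2 * n % 2 ≡ᵇ 1) ∷ bits (2 * n / 2))
      ≡⟨ cong₂ (λ r q → countOnes ((r ≡ᵇ 1) ∷ bits q)) ([2n]%2≡0 n) ([2n]/2≡n n) ⟩
    countOnes (bits n) ∎
    where open ≡-Reasoning

  s[1+2n]≡1+s[n] : ∀ n → s (suc (2 * n)) ≡ suc (s n)
  s[1+2n]≡1+s[n] n = begin
    countOnes (bits (suc (2 * n)))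
      ≡⟨ cong countOnes (bits-nonZero (suc (2 * n))) ⟩
    countOnes ((suc (2 * n) % 2 ≡ᵇ 1) ∷ bits (suc (2 * n) / 2))
      ≡⟨ cong₂ (λ r q → countOnes ((r ≡ᵇ 1) ∷ bits q)) ([1+2n]%2≡1 n) ([1+2n]/2≡n n) ⟩
    suc (countOnes (bits n)) ∎
    where open ≡-Reasoning

  fromBits-bitsAux : ∀ f n → n ≤ f → fromBits (bitsAux f n) ≡ n
  fromBits-bitsAux zero    zero    _         = refl
  fromBits-bitsAux (suc f) zero    _         = refl
  fromBits-bitsAux (suc f) (suc n) (s≤s n≤f) = begin
    bitValue (suc n % 2) + 2 * fromBits (bitsAux f (suc n / 2))
      ≡⟨ cong₂ (λ b r → b + 2 * r) (bitValue-% (suc n)) (fromBits-bitsAux f (suc n / 2) (≤-trans ([1+n]/2≤n n) n≤f)) ⟩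
    suc n % 2 + 2 * (suc n / 2)  ≡⟨ cong (suc n % 2 +_) (*-comm 2 (suc n / 2)) ⟩
    suc n % 2 + suc n / 2 * 2    ≡⟨ m≡m%n+[m/n]*n (suc n) 2 ⟨
    suc n                        ∎
    where
    open ≡-Reasoning
    bitValue : ℕ → ℕ
    bitValue r = if r ≡ᵇ 1 then 1 else 0
    bitValue-% : ∀ m → bitValue (m % 2) ≡ m % 2
    bitValue-% m with m % 2 | m%n<n m 2
    ... | 0 | _ = refl
    ... | 1 | _ = refl
    ... | suc (suc _) | s≤s (s≤s ())

  fromBits-bits : ∀ t → fromBits (bits t) ≡ t
  fromBits-bits t = fromBits-bitsAux t t ≤-refl

module Counting where
  open import Data.Bool using (Bool; true; false; if_then_else_)
  open import Data.Nat
  open import Data.Nat.Properties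
  open import Data.Nat.DivMod using (m%n<n; m≡m%n+[m/n]*n; m/n<m)
  open import Data.Nat.Induction using (<-rec)
  open import Data.Nat.Tactic.RingSolver using (solve-∀)
  open import Data.Integer using (+_; 0ℤ; 1ℤ)
  import Data.Integer.Properties as ℤₚ
  import Data.Integer.Tactic.RingSolver as ℤ-Solver
  open import Data.List using ([]; _∷_; length; reverse)
  open import Data.List.Properties using (length-reverse)
  open import Data.Product using (Σ; proj₁)
  open import Data.Empty using (⊥-elim)
  open import Function using (_∘_; _⇔_; mk⇔)
  open import Relation.Binary.Definitions using (tri<; tri≈; tri>)
  open import Relation.Binary.PropositionalEquality
  open import Relation.Nullary.Decidable using (yes; no; does; does-⇔; dec-true; dec-false)
  open ShiftOperators using (Pair; _≈_; ≈-refl; ≈-trans; step; steps; step-cong; seed; ⟦_⟧; ⟦⟧-reverse; Near; Near-steps)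
  open BinaryDigits

  ι : Bool → ℕ
  ι b = if b then 1 else 0

  count-cong : ∀ {P Q} → (∀ n → P n ≡ Q n) → ∀ N → count P N ≡ count Q N
  count-cong eq zero    = refl
  count-cong eq (suc N) = cong₂ _+_ (cong ι (eq N)) (count-cong eq N)

  count-+ : ∀ {P Q R} → (∀ n → ι (P n) ≡ ι (Q n) + ι (R n)) → ∀ N → count P N ≡ count Q N + count R N
  count-+ eq zero = refl
  count-+ {P} {Q} {R} eq (suc N) =
    trans (cong₂ _+_ (eq N) (count-+ eq N)) (interchange (ι (Q N)) (ι (R N)) (count Q N) (count R N))
    where
    interchange : ∀ a b c d → (a + b) + (c + d) ≡ (a + c) + (b + d)
    interchange = solve-∀

  count-const : ∀ b N → count (λ _ → b) N ≡ ι b * N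
  count-const b zero    = sym (*-zeroʳ (ι b))
  count-const b (suc N) = trans (cong (_+_ (ι b)) (count-const b N)) (sym (*-suc (ι b) N))

  count-double : ∀ P N → count P (2 * N) ≡ count (λ n → P (2 * n)) N + count (λ n → P (suc (2 * n))) N
  count-double P zero    = refl
  count-double P (suc N) = begin
    count P (2 * suc N)
      ≡⟨ cong (count P) (2[1+n]≡2+2n N) ⟩
    ι (P (suc (2 * N))) + (ι (P (2 * N)) + count P (2 * N))
      ≡⟨ cong (λ c → ι (P (suc (2 * N))) + (ι (P (2 * N)) + c)) (count-double P N) ⟩
    ι (P (suc (2 * N))) + (ι (P (2 * N)) + (cₑ + cₒ))
      ≡⟨ rearrange (ι (P (suc (2 * N)))) (ι (P (2 * N))) cₑ cₒ ⟩
    (ι (P (2 * N)) + cₑ) + (ι (P (suc (2 * N))) + cₒ) ∎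
    where
    open ≡-Reasoning
    cₑ = count (λ n → P (2 * n)) N
    cₒ = count (λ n → P (suc (2 * n))) N
    2[1+n]≡2+2n : ∀ n → 2 * suc n ≡ suc (suc (2 * n))
    2[1+n]≡2+2n = solve-∀
    rearrange : ∀ a b c d → a + (b + (c + d)) ≡ (b + c) + (a + d)
    rearrange = solve-∀

  count-increment-≤ : ∀ P r m → ∣ count P (r + m) - count P m ∣ ≤ r
  count-increment-≤ P zero    m = ≤-reflexive (∣n-n∣≡0 (count P m))
  count-increment-≤ P (suc r) m = begin
    ∣ ι (P (r + m)) + count P (r + m) - count P m ∣
      ≤⟨ ∣-∣-triangle (ι (P (r + m)) + count P (r + m)) (count P (r + m)) (count P m) ⟩
    ∣ ι (P (r + m)) + count P (r + m) - count P (r + m) ∣ + ∣ count P (r + m) - count P m ∣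
      ≡⟨ cong (_+ ∣ count P (r + m) - count P m ∣) (∣m+n-n∣≡m (ι (P (r + m))) (count P (r + m))) ⟩
    ι (P (r + m)) + ∣ count P (r + m) - count P m ∣
      ≤⟨ +-mono-≤ (ι≤1 (P (r + m))) (count-increment-≤ P r m) ⟩
    suc r ∎
    where
    open ≤-Reasoning
    ι≤1 : ∀ b → ι b ≤ 1
    ι≤1 true  = ≤-refl
    ι≤1 false = z≤n
    ∣m+n-n∣≡m : ∀ m n → ∣ m + n - n ∣ ≡ m
    ∣m+n-n∣≡m m n = trans (m≤n⇒∣n-m∣≡n∸m (m≤n+m n m)) (m+n∸n≡m m n)

  ∣m-n∣≤∣[m+o]-[n+p]∣+∣o-p∣ : ∀ m n o p → ∣ m - n ∣ ≤ ∣ (m + o) - (n + p) ∣ + ∣ o - p ∣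
  ∣m-n∣≤∣[m+o]-[n+p]∣+∣o-p∣ m n o p = begin
    ∣ m - n ∣
      ≡⟨ ∣m+n-m+o∣≡∣n-o∣ o m n ⟨
    ∣ o + m - o + n ∣
      ≡⟨ cong₂ ∣_-_∣ (+-comm o m) (+-comm o n) ⟩
    ∣ (m + o) - (n + o) ∣
      ≤⟨ ∣-∣-triangle (m + o) (n + p) (n + o) ⟩
    ∣ (m + o) - (n + p) ∣ + ∣ (n + p) - (n + o) ∣
      ≡⟨ cong (_+_ ∣ (m + o) - (n + p) ∣) (trans (∣m+n-m+o∣≡∣n-o∣ n p o) (∣-∣-comm p o)) ⟩
    ∣ (m + o) - (n + p) ∣ + ∣ o - p ∣ ∎
    where open ≤-Reasoning

  ∣+m-+n∣≡∣m-n∣ : ∀ m n → ℤ.∣ + m ℤ.- + n ∣ ≡ ∣ m - n ∣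
  ∣+m-+n∣≡∣m-n∣ m n = trans (cong ℤ.∣_∣ (ℤₚ.[+m]-[+n]≡m⊖n m n)) (∣m⊖n∣≡∣m-n∣ m n)
    where
    ∣m⊖n∣≡∣m-n∣ : ∀ m n → ℤ.∣ m ℤ.⊖ n ∣ ≡ ∣ m - n ∣
    ∣m⊖n∣≡∣m-n∣ zero    zero    = refl
    ∣m⊖n∣≡∣m-n∣ zero    (suc n) = refl
    ∣m⊖n∣≡∣m-n∣ (suc m) zero    = refl
    ∣m⊖n∣≡∣m-n∣ (suc m) (suc n) = trans (cong ℤ.∣_∣ (ℤₚ.[1+m]⊖[1+n]≡m⊖n m n)) (∣m⊖n∣≡∣m-n∣ m n)

  ∣i-j∣≤∣i-k∣+∣j-k∣ : ∀ i j k → ℤ.∣ i ℤ.- j ∣ ≤ ℤ.∣ i ℤ.- k ∣ + ℤ.∣ j ℤ.- k ∣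
  ∣i-j∣≤∣i-k∣+∣j-k∣ i j k = begin
    ℤ.∣ i ℤ.- j ∣                  ≡⟨ cong ℤ.∣_∣ (split i j k) ⟩
    ℤ.∣ (i ℤ.- k) ℤ.+ (k ℤ.- j) ∣  ≤⟨ ℤₚ.∣i+j∣≤∣i∣+∣j∣ (i ℤ.- k) (k ℤ.- j) ⟩
    ℤ.∣ i ℤ.- k ∣ + ℤ.∣ k ℤ.- j ∣  ≡⟨ cong (_+_ ℤ.∣ i ℤ.- k ∣) (ℤₚ.∣i-j∣≡∣j-i∣ k j) ⟩
    ℤ.∣ i ℤ.- k ∣ + ℤ.∣ j ℤ.- k ∣  ∎
    where
    open ≤-Reasoning
    split : ∀ i j k → i ℤ.- j ≡ (i ℤ.- k) ℤ.+ (k ℤ.- j)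
    split = ℤ-Solver.solve-∀

  BoundedDifference : (ℕ → Bool) → (ℕ → Bool) → Set
  BoundedDifference P Q = Σ ℕ λ C → ∀ N → ∣ count P N - count Q N ∣ ≤ C

  BoundedDifference⇒SameDensity : ∀ {P Q} → BoundedDifference P Q → SameDensity P Q
  BoundedDifference⇒SameDensity (C , bounded) k =
    suc (suc k * C) , λ N N₀≤N → ≤-trans (s≤s (*-monoʳ-≤ (suc k) (bounded N))) N₀≤N

  BoundedDifference-cancelʳ : ∀ {P Q P′ Q′ R S} →
    (∀ N → count P N ≡ count P′ N + count R N) → (∀ N → count Q N ≡ count Q′ N + count S N) →
    BoundedDifference P Q → BoundedDifference R S → BoundedDifference P′ Q′
  BoundedDifference-cancelʳ {P′ = P′} {Q′} {R} {S} splitP splitQ (C , boundPQ) (D , boundRS) = C + D , λ N →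
    ≤-trans (∣m-n∣≤∣[m+o]-[n+p]∣+∣o-p∣ (count P′ N) (count Q′ N) (count R N) (count S N))
            (+-mono-≤ (subst₂ (λ x y → ∣ x - y ∣ ≤ C) (splitP N) (splitQ N) (boundPQ N)) (boundRS N))

  binary-induction : (P : ℕ → Set) → P 0 → (∀ n → P n → P (2 * n)) → (∀ n → P n → P (suc (2 * n))) →
                     ∀ n → P n
  binary-induction P p₀ p-double p-double+1 = <-rec P induct
    where
    induct : ∀ n → (∀ {m} → m < n → P m) → P n
    induct zero      _   = p₀
    induct n@(suc _) rec with n % 2 | m%n<n n 2 | m≡m%n+[m/n]*n n 2
    ... | 0 | _ | n≡2h =
      subst P (sym (trans n≡2h (*-comm (n / 2) 2))) (p-double (n / 2) (rec (m/n<m n 2 ≤-refl)))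
    ... | 1 | _ | n≡1+2h =
      subst P (sym (trans n≡1+2h (cong suc (*-comm (n / 2) 2)))) (p-double+1 (n / 2) (rec (m/n<m n 2 ≤-refl)))
    ... | suc (suc _) | s≤s (s≤s ()) | _

  δ[2t,2n]≡δ[t,n] : ∀ t n → δ (2 * t) (2 * n) ≡ δ t n
  δ[2t,2n]≡δ[t,n] t n =
    cong₂ (λ a b → + a ℤ.- + b) (trans (cong s (sym (*-distribˡ-+ 2 n t))) (s[2n]≡s[n] (n + t))) (s[2n]≡s[n] n)

  δ[2t,1+2n]≡δ[t,n] : ∀ t n → δ (2 * t) (suc (2 * n)) ≡ δ t n
  δ[2t,1+2n]≡δ[t,n] t n =
    trans (cong₂ (λ a b → + a ℤ.- + b) (trans (cong (λ m → s (suc m)) (sym (*-distribˡ-+ 2 n t)))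
                                                (s[1+2n]≡1+s[n] (n + t)))
                                         (s[1+2n]≡1+s[n] n))
          (cancel (+ s (n + t)) (+ s n))
    where
    cancel : ∀ a b → (1ℤ ℤ.+ a) ℤ.- (1ℤ ℤ.+ b) ≡ a ℤ.- b
    cancel = ℤ-Solver.solve-∀

  δ[1+2t,2n]≡1+δ[t,n] : ∀ t n → δ (suc (2 * t)) (2 * n) ≡ ℤ.suc (δ t n)
  δ[1+2t,2n]≡1+δ[t,n] t n =
    trans (cong₂ (λ a b → + a ℤ.- + b) (trans (cong s (2m+[1+2n]≡1+2[m+n] n t)) (s[1+2n]≡1+s[n] (n + t)))
                                         (s[2n]≡s[n] n))
          (reassociate (+ s (n + t)) (+ s n))
    where
    2m+[1+2n]≡1+2[m+n] : ∀ m n → 2 * m + suc (2 * n) ≡ suc (2 * (m + n))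
    2m+[1+2n]≡1+2[m+n] = solve-∀
    reassociate : ∀ a b → (1ℤ ℤ.+ a) ℤ.- b ≡ 1ℤ ℤ.+ (a ℤ.- b)
    reassociate = ℤ-Solver.solve-∀

  δ[1+2t,1+2n]≡δ[1+t,n]-1 : ∀ t n → δ (suc (2 * t)) (suc (2 * n)) ≡ ℤ.pred (δ (suc t) n)
  δ[1+2t,1+2n]≡δ[1+t,n]-1 t n =
    trans (cong₂ (λ a b → + a ℤ.- + b) (trans (cong s ([1+2m]+[1+2n]≡2[m+1+n] n t)) (s[2n]≡s[n] (n + suc t)))
                                         (s[1+2n]≡1+s[n] n))
          (reassociate (+ s (n + suc t)) (+ s n))
    where
    [1+2m]+[1+2n]≡2[m+1+n] : ∀ m n → suc (2 * m) + suc (2 * n) ≡ 2 * (m + suc n)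
    [1+2m]+[1+2n]≡2[m+1+n] = solve-∀
    reassociate : ∀ a b → a ℤ.- (1ℤ ℤ.+ b) ≡ ℤ.-1ℤ ℤ.+ (a ℤ.- b)
    reassociate = ℤ-Solver.solve-∀

  δ≥ : ℕ → ℤ → ℕ → Bool
  δ≥ t j n = does (j ℤ.≤? δ t n)

  atLeast : ℕ → ℤ → ℕ → ℕ
  atLeast t j = count (δ≥ t j)

  ≤-suc⇔pred-≤ : ∀ {i j} → i ℤ.≤ ℤ.suc j ⇔ ℤ.pred i ℤ.≤ j
  ≤-suc⇔pred-≤ {i} {j} = mk⇔ (λ i≤1+j → subst (ℤ.pred i ℤ.≤_) (ℤₚ.pred-suc j) (ℤₚ.pred-mono i≤1+j))
                             (λ i-1≤j → subst (ℤ._≤ ℤ.suc j) (ℤₚ.suc-pred i) (ℤₚ.suc-mono i-1≤j))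

  ≤-pred⇔suc-≤ : ∀ {i j} → i ℤ.≤ ℤ.pred j ⇔ ℤ.suc i ℤ.≤ j
  ≤-pred⇔suc-≤ {i} {j} = mk⇔ (λ i≤j-1 → subst (ℤ.suc i ℤ.≤_) (ℤₚ.suc-pred j) (ℤₚ.suc-mono i≤j-1))
                             (λ 1+i≤j → subst (ℤ._≤ ℤ.pred j) (ℤₚ.pred-suc i) (ℤₚ.pred-mono 1+i≤j))

  atLeast-even : ∀ t j N → atLeast (2 * t) j (2 * N) ≡ atLeast t j N + atLeast t j N
  atLeast-even t j N = trans (count-double (δ≥ (2 * t) j) N)
    (cong₂ _+_ (count-cong (λ n → cong (does ∘ (j ℤ.≤?_)) (δ[2t,2n]≡δ[t,n] t n)) N)
               (count-cong (λ n → cong (does ∘ (j ℤ.≤?_)) (δ[2t,1+2n]≡δ[t,n] t n)) N))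

  atLeast-odd : ∀ t j N → atLeast (suc (2 * t)) j (2 * N) ≡ atLeast t (ℤ.pred j) N + atLeast (suc t) (ℤ.suc j) N
  atLeast-odd t j N = trans (count-double (δ≥ (suc (2 * t)) j) N)
    (cong₂ _+_ (count-cong (λ n → trans (cong (does ∘ (j ℤ.≤?_)) (δ[1+2t,2n]≡1+δ[t,n] t n))
                                        (does-⇔ ≤-suc⇔pred-≤ (j ℤ.≤? _) (ℤ.pred j ℤ.≤? _))) N)
               (count-cong (λ n → trans (cong (does ∘ (j ℤ.≤?_)) (δ[1+2t,1+2n]≡δ[1+t,n]-1 t n))
                                        (does-⇔ ≤-pred⇔suc-≤ (j ℤ.≤? _) (ℤ.suc j ℤ.≤? _))) N))

  tails : ℕ → ℕ → Pair
  tails t N = (λ j → + atLeast t j N) , (λ j → + atLeast (suc t) j N)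

  tails-double : ∀ t N → tails (2 * t) (2 * N) ≈ step false (tails t N)
  tails-double t N = (λ j → cong +_ (atLeast-even t j N)) , (λ j → cong +_ (atLeast-odd t j N))

  tails-double+1 : ∀ t N → tails (suc (2 * t)) (2 * N) ≈ step true (tails t N)
  tails-double+1 t N =
    (λ j → cong +_ (atLeast-odd t j N)) ,
    (λ j → cong +_ (trans (cong (λ u → atLeast u j (2 * N)) (2+2n≡2[1+n] t)) (atLeast-even (suc t) j N)))
    where
    2+2n≡2[1+n] : ∀ n → suc (suc (2 * n)) ≡ 2 * suc n
    2+2n≡2[1+n] = solve-∀

  tails-fromBits : ∀ l N → tails (fromBits l) (2 ^ length l * N) ≈ steps l (tails 0 N)
  tails-fromBits [] N rewrite +-identityʳ N = ≈-refl
  tails-fromBits (b ∷ l) N rewrite *-assoc 2 (2 ^ length l) N =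
    ≈-trans (digit b) (step-cong b (tails-fromBits l N))
    where
    digit : ∀ b → tails (fromBits (b ∷ l)) (2 * (2 ^ length l * N)) ≈ step b (tails (fromBits l) (2 ^ length l * N))
    digit false = tails-double (fromBits l) (2 ^ length l * N)
    digit true  = tails-double+1 (fromBits l) (2 ^ length l * N)

  δ[0,n]≡0 : ∀ n → δ 0 n ≡ 0ℤ
  δ[0,n]≡0 n = trans (cong (λ m → + s m ℤ.- + s n) (+-identityʳ n)) (ℤₚ.+-inverseʳ (+ s n))

  atLeast₀ : ∀ j N → atLeast 0 j N ≡ ι (does (j ℤ.≤? 0ℤ)) * N
  atLeast₀ j N = trans (count-cong (λ n → cong (does ∘ (j ℤ.≤?_)) (δ[0,n]≡0 n)) N) (count-const _ N)

  [_≤1] : ℤ → ℕ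
  [ k ≤1] = ι (does (k ℤ.≤? 1ℤ))

  atLeast₁-double : ∀ k N → atLeast 1 k (2 * N) ≡ [ k ≤1] * N + atLeast 1 (ℤ.suc k) N
  atLeast₁-double k N = begin
    atLeast 1 k (2 * N)                  ≡⟨ atLeast-odd 0 k N ⟩
    atLeast 0 (ℤ.pred k) N + a           ≡⟨ cong (_+ a) (atLeast₀ (ℤ.pred k) N) ⟩
    ι (does (ℤ.pred k ℤ.≤? 0ℤ)) * N + a  ≡⟨ cong (λ b → ι b * N + a) (does-⇔ ≤-suc⇔pred-≤ (k ℤ.≤? 1ℤ) (ℤ.pred k ℤ.≤? 0ℤ)) ⟨
    [ k ≤1] * N + a                      ∎
    where
    open ≡-Reasoning
    a = atLeast 1 (ℤ.suc k) N

  atLeast₁-double+1 : ∀ k N → atLeast 1 k (suc (2 * N)) ≡ [ k ≤1] + atLeast 1 k (2 * N)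
  atLeast₁-double+1 k N =
    cong (λ d → ι (does (k ℤ.≤? d)) + atLeast 1 k (2 * N)) (trans (δ[1+2t,2n]≡1+δ[t,n] 0 N) (cong ℤ.suc (δ[0,n]≡0 N)))

  -- ε is in fact the binary digit of N in position 1 − k (and 0 when k ≥ 2).
  record HalvingDefect (k : ℤ) (N : ℕ) : Set where
    field
      ε      : ℕ
      ε≤1    : ε ≤ 1
      ε≡0    : 1ℤ ℤ.< k → ε ≡ 0
      halves : 2 * atLeast 1 k N ≡ atLeast 1 k (2 * N) + ε

  halvingDefect-double : ∀ k M → HalvingDefect (ℤ.suc k) M → HalvingDefect k (2 * M)
  halvingDefect-double k M d = record
    { ε      = ε
    ; ε≤1    = ε≤1
    ; ε≡0    = λ 1<k → ε≡0 (ℤₚ.<-≤-trans 1<k (ℤₚ.i≤suc[i] k))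
    ; halves = begin
        2 * atLeast 1 k (2 * M)                                ≡⟨ cong (2 *_) (atLeast₁-double k M) ⟩
        2 * ([ k ≤1] * M + atLeast 1 (ℤ.suc k) M)              ≡⟨ distribute [ k ≤1] M (atLeast 1 (ℤ.suc k) M) ⟩
        [ k ≤1] * (2 * M) + 2 * atLeast 1 (ℤ.suc k) M          ≡⟨ cong (_+_ ([ k ≤1] * (2 * M))) halves ⟩
        [ k ≤1] * (2 * M) + (atLeast 1 (ℤ.suc k) (2 * M) + ε)  ≡⟨ +-assoc ([ k ≤1] * (2 * M)) _ ε ⟨
        [ k ≤1] * (2 * M) + atLeast 1 (ℤ.suc k) (2 * M) + ε    ≡⟨ cong (_+ ε) (atLeast₁-double k (2 * M)) ⟨
        atLeast 1 k (2 * (2 * M)) + ε                          ∎ }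
    where
    open HalvingDefect d
    open ≡-Reasoning
    distribute : ∀ i m a → 2 * (i * m + a) ≡ i * (2 * m) + 2 * a
    distribute = solve-∀

  halvingDefect-correction : ∀ k {ε} → ε ≤ 1 → (1ℤ ℤ.< ℤ.suc k → ε ≡ 0) →
    Σ ℕ λ ε′ → ε′ ≤ 1 × (1ℤ ℤ.< k → ε′ ≡ 0) × ([ k ≤1] + ε ≡ [ ℤ.suc k ≤1] + ε′)
  halvingDefect-correction k {ε} ε≤1 ε≡0 with ℤₚ.<-cmp k 1ℤ
  ... | tri< k<1 _ _ = ε , ε≤1 , (λ 1<k → ⊥-elim (ℤₚ.<-asym k<1 1<k)) , both-one
    where
    both-one : [ k ≤1] + ε ≡ [ ℤ.suc k ≤1] + ε
    both-one rewrite dec-true (k ℤ.≤? 1ℤ) (ℤₚ.<⇒≤ k<1)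
                   | dec-true (ℤ.suc k ℤ.≤? 1ℤ) (ℤₚ.i<j⇒suc[i]≤j k<1) = refl
  ... | tri≈ _ refl _ = 1 , ≤-refl , (λ 1<1 → ⊥-elim (ℤₚ.<-irrefl refl 1<1)) ,
                        cong suc (ε≡0 (ℤ.+<+ (s≤s (s≤s z≤n))))
  ... | tri> _ _ 1<k = 0 , z≤n , (λ _ → refl) , both-zero
    where
    1<1+k = ℤₚ.<-≤-trans 1<k (ℤₚ.i≤suc[i] k)
    both-zero : [ k ≤1] + ε ≡ [ ℤ.suc k ≤1] + 0
    both-zero rewrite dec-false (k ℤ.≤? 1ℤ) (ℤₚ.<⇒≱ 1<k)
                    | dec-false (ℤ.suc k ℤ.≤? 1ℤ) (ℤₚ.<⇒≱ 1<1+k) = ε≡0 1<1+k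

  halves-double+1 : ∀ k M {ε ε′} → 2 * atLeast 1 (ℤ.suc k) M ≡ atLeast 1 (ℤ.suc k) (2 * M) + ε →
    [ k ≤1] + ε ≡ [ ℤ.suc k ≤1] + ε′ → 2 * atLeast 1 k (suc (2 * M)) ≡ atLeast 1 k (2 * suc (2 * M)) + ε′
  halves-double+1 k M {ε} {ε′} halves corrected = begin
    2 * atLeast 1 k (suc (2 * M))
      ≡⟨ cong (2 *_) (trans (atLeast₁-double+1 k M)
                                                                            (cong (_+_ [ k ≤1]) (atLeast₁-double k M))) ⟩
    2 * ([ k ≤1] + ([ k ≤1] * M + a))
      ≡⟨ expand [ k ≤1] M a ⟩
    [ k ≤1] * suc (2 * M) + ([ k ≤1] + 2 * a)
      ≡⟨ cong (λ x → [ k ≤1] * suc (2 * M) + ([ k ≤1] + x)) halves ⟩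
    [ k ≤1] * suc (2 * M) + ([ k ≤1] + (a′ + ε))
      ≡⟨ cong (_+_ ([ k ≤1] * suc (2 * M))) rebalance ⟩
    [ k ≤1] * suc (2 * M) + ([ ℤ.suc k ≤1] + a′ + ε′)
      ≡⟨ +-assoc ([ k ≤1] * suc (2 * M)) _ ε′ ⟨
    [ k ≤1] * suc (2 * M) + ([ ℤ.suc k ≤1] + a′) + ε′
      ≡⟨ cong (λ x → [ k ≤1] * suc (2 * M) + x + ε′) (atLeast₁-double+1 (ℤ.suc k) M) ⟨
    [ k ≤1] * suc (2 * M) + atLeast 1 (ℤ.suc k) (suc (2 * M)) + ε′ ≡⟨ cong (_+ ε′) (atLeast₁-double k (suc (2 * M))) ⟨
    atLeast 1 k (2 * suc (2 * M)) + ε′ ∎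
    where
    open ≡-Reasoning
    a = atLeast 1 (ℤ.suc k) M
    a′ = atLeast 1 (ℤ.suc k) (2 * M)
    expand : ∀ i m a → 2 * (i + (i * m + a)) ≡ i * suc (2 * m) + (i + 2 * a)
    expand = solve-∀
    swap : ∀ a b c → a + (b + c) ≡ b + (a + c)
    swap = solve-∀
    rebalance : [ k ≤1] + (a′ + ε) ≡ [ ℤ.suc k ≤1] + a′ + ε′
    rebalance = begin
      [ k ≤1] + (a′ + ε)         ≡⟨ swap [ k ≤1] a′ ε ⟩
      a′ + ([ k ≤1] + ε)         ≡⟨ cong (_+_ a′) corrected ⟩
      a′ + ([ ℤ.suc k ≤1] + ε′)  ≡⟨ swap a′ [ ℤ.suc k ≤1] ε′ ⟩
      [ ℤ.suc k ≤1] + (a′ + ε′)  ≡⟨ +-assoc [ ℤ.suc k ≤1] a′ ε′ ⟨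
      [ ℤ.suc k ≤1] + a′ + ε′    ∎

  halvingDefect-double+1 : ∀ k M → HalvingDefect (ℤ.suc k) M → HalvingDefect k (suc (2 * M))
  halvingDefect-double+1 k M d with halvingDefect-correction k (HalvingDefect.ε≤1 d) (HalvingDefect.ε≡0 d)
  ... | ε′ , ε′≤1 , ε′≡0 , corrected = record
    { ε = ε′ ; ε≤1 = ε′≤1 ; ε≡0 = ε′≡0 ; halves = halves-double+1 k M (HalvingDefect.halves d) corrected }

  halvingDefect : ∀ N k → HalvingDefect k N
  halvingDefect = binary-induction (λ N → ∀ k → HalvingDefect k N)
    (λ k → record { ε = 0 ; ε≤1 = z≤n ; ε≡0 = λ _ → refl ; halves = refl })
    (λ M d k → halvingDefect-double k M (d (ℤ.suc k)))
    (λ M d k → halvingDefect-double+1 k M (d (ℤ.suc k)))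

  tails₀-near-seed : ∀ N → Near 1 (tails 0 N) (seed (λ j → + atLeast 1 j N))
  tails₀-near-seed N = first , (λ j → subst (_≤ 1) (sym (cong ℤ.∣_∣ (ℤₚ.+-inverseʳ (+ atLeast 1 j N)))) z≤n)
    where
    deviation : ∀ a₀ a₁ c e → a₁ ℤ.+ a₁ ≡ (a₀ ℤ.+ c) ℤ.+ e → a₀ ℤ.- ((a₁ ℤ.+ a₁) ℤ.- c) ≡ ℤ.- e
    deviation a₀ a₁ c e eq = trans (cong (λ x → a₀ ℤ.- (x ℤ.- c)) eq) (ring a₀ c e)
      where
      ring : ∀ a₀ c e → a₀ ℤ.- (((a₀ ℤ.+ c) ℤ.+ e) ℤ.- c) ≡ ℤ.- e
      ring = ℤ-Solver.solve-∀
    first : ∀ j → ℤ.∣ + atLeast 0 j N ℤ.- proj₁ (seed (λ j → + atLeast 1 j N)) j ∣ ≤ 1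
    first j = begin
      ℤ.∣ + atLeast 0 j N ℤ.- ((+ a₁ ℤ.+ + a₁) ℤ.- + c) ∣
        ≡⟨ cong ℤ.∣_∣ (deviation (+ atLeast 0 j N) (+ a₁) (+ c) (+ ε) (cong +_ doubled)) ⟩
      ℤ.∣ ℤ.- + ε ∣
        ≡⟨ ℤₚ.∣-i∣≡∣i∣ (+ ε) ⟩
      ε
        ≤⟨ ε≤1 ⟩
      1 ∎
      where
      open HalvingDefect (halvingDefect N (ℤ.suc j))
      open ≤-Reasoning
      a₁ = atLeast 1 (ℤ.suc j) N
      c = atLeast 1 (ℤ.suc (ℤ.suc j)) N
      doubled : a₁ + a₁ ≡ (atLeast 0 j N + c) + ε
      doubled = begin-equality
        a₁ + a₁
          ≡⟨ cong (_+_ a₁) (+-identityʳ a₁) ⟨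
        2 * a₁
          ≡⟨ halves ⟩
        atLeast 1 (ℤ.suc j) (2 * N) + ε
          ≡⟨ cong (_+ ε) (atLeast-odd 0 (ℤ.suc j) N) ⟩
        atLeast 0 (ℤ.pred (ℤ.suc j)) N + c + ε
          ≡⟨ cong (λ i → atLeast 0 i N + c + ε) (ℤₚ.pred-suc j) ⟩
        atLeast 0 j N + c + ε ∎

  atLeast-rev-multiple : ∀ t j q → let L = length (bits t) in
    ∣ atLeast t j (2 ^ L * q) - atLeast (rev t) j (2 ^ L * q) ∣ ≤ 2 ^ L + 2 ^ L
  atLeast-rev-multiple t j q = begin
    ∣ a - a′ ∣
      ≡⟨ ∣+m-+n∣≡∣m-n∣ a a′ ⟨
    ℤ.∣ + a ℤ.- + a′ ∣
      ≡⟨ cong₂ (λ y y′ → ℤ.∣ y ℤ.- y′ ∣) tails-t tails-rev ⟩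
    ℤ.∣ x ℤ.- x′ ∣
      ≤⟨ ∣i-j∣≤∣i-k∣+∣j-k∣ x x′ (⟦ l ⟧ g j) ⟩
    ℤ.∣ x ℤ.- ⟦ l ⟧ g j ∣ + ℤ.∣ x′ ℤ.- ⟦ l ⟧ g j ∣
      ≡⟨ cong (λ y → ℤ.∣ x ℤ.- ⟦ l ⟧ g j ∣ + ℤ.∣ x′ ℤ.- y ∣)
                                                                   (⟦⟧-reverse l g j) ⟩
    ℤ.∣ x ℤ.- ⟦ l ⟧ g j ∣ + ℤ.∣ x′ ℤ.- ⟦ reverse l ⟧ g j ∣
      ≤⟨ +-mono-≤ (near l) (near (reverse l)) ⟩
    2 ^ L * 1 + 2 ^ length (reverse l) * 1
      ≡⟨ cong₂ _+_ (*-identityʳ (2 ^ L))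
                                                                    (trans (*-identityʳ _) (cong (2 ^_) (length-reverse l))) ⟩
    2 ^ L + 2 ^ L ∎
    where
    open ≤-Reasoning
    l = bits t
    L = length l
    a = atLeast t j (2 ^ L * q)
    a′ = atLeast (rev t) j (2 ^ L * q)
    v = tails 0 q
    x = proj₁ (steps l v) j
    x′ = proj₁ (steps (reverse l) v) j
    g = λ i → + atLeast 1 i q
    near : ∀ w → ℤ.∣ proj₁ (steps w v) j ℤ.- ⟦ w ⟧ g j ∣ ≤ 2 ^ length w * 1
    near w = proj₁ (Near-steps w (tails₀-near-seed q)) j
    tails-t : + a ≡ x
    tails-t = trans (cong (λ u → + atLeast u j (2 ^ L * q)) (sym (fromBits-bits t))) (proj₁ (tails-fromBits l q) j)
    tails-rev : + a′ ≡ x′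
    tails-rev = trans (cong (λ n → + atLeast (rev t) j (2 ^ n * q)) (sym (length-reverse l)))
                      (proj₁ (tails-fromBits (reverse l) q) j)

  atLeast-rev-bounded : ∀ t j → BoundedDifference (δ≥ t j) (δ≥ (rev t) j)
  atLeast-rev-bounded t j = 2ᴸ + ((2ᴸ + 2ᴸ) + 2ᴸ) , bound
    where
    2ᴸ = 2 ^ length (bits t)
    instance
      2ᴸ-nonZero : NonZero 2ᴸ
      2ᴸ-nonZero = m^n≢0 2 (length (bits t))
    bound : ∀ N → ∣ atLeast t j N - atLeast (rev t) j N ∣ ≤ 2ᴸ + ((2ᴸ + 2ᴸ) + 2ᴸ)
    bound N = begin
      ∣ F N - F′ N ∣                               ≤⟨ ∣-∣-triangle (F N) (F m) (F′ N) ⟩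
      ∣ F N - F m ∣ + ∣ F m - F′ N ∣               ≤⟨ +-monoʳ-≤ ∣ F N - F m ∣ (∣-∣-triangle (F m) (F′ m) (F′ N)) ⟩
      ∣ F N - F m ∣ + (∣ F m - F′ m ∣ + ∣ F′ m - F′ N ∣)
        ≤⟨ +-mono-≤ (remainder t) (+-mono-≤ (atLeast-rev-multiple t j q)
                                           (subst (_≤ 2ᴸ) (∣-∣-comm (F′ N) (F′ m)) (remainder (rev t)))) ⟩
      2ᴸ + ((2ᴸ + 2ᴸ) + 2ᴸ)                        ∎
      where
      open ≤-Reasoning
      q = N / 2ᴸ
      r = N % 2ᴸ
      m = 2ᴸ * q
      N≡r+m : N ≡ r + m
      N≡r+m = trans (m≡m%n+[m/n]*n N 2ᴸ) (cong (_+_ r) (*-comm q 2ᴸ))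
      F F′ : ℕ → ℕ
      F  = atLeast t j
      F′ = atLeast (rev t) j
      remainder : ∀ u → ∣ atLeast u j N - atLeast u j m ∣ ≤ 2ᴸ
      remainder u = begin
        ∣ atLeast u j N - atLeast u j m ∣         ≡⟨ cong (λ n → ∣ atLeast u j n - atLeast u j m ∣) N≡r+m ⟩
        ∣ atLeast u j (r + m) - atLeast u j m ∣   ≤⟨ count-increment-≤ (δ≥ u j) r m ⟩
        r                                          ≤⟨ <⇒≤ (m%n<n N 2ᴸ) ⟩
        2ᴸ                                         ∎

  [j≤x]≡[x≡j]+[1+j≤x] : ∀ j x → ι (does (j ℤ.≤? x)) ≡ ι (does (x ℤ.≟ j)) + ι (does (ℤ.suc j ℤ.≤? x))
  [j≤x]≡[x≡j]+[1+j≤x] j x with x ℤ.≟ j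
  ... | yes refl rewrite dec-true (x ℤ.≤? x) ℤₚ.≤-refl
                       | dec-false (ℤ.suc x ℤ.≤? x) (ℤₚ.<⇒≱ (ℤₚ.suc[i]≤j⇒i<j ℤₚ.≤-refl)) = refl
  ... | no x≢j = cong ι (does-⇔ (mk⇔ (λ j≤x → ℤₚ.i<j⇒suc[i]≤j (ℤₚ.≤∧≢⇒< j≤x (x≢j ∘ sym)))
                                      (λ 1+j≤x → ℤₚ.≤-trans (ℤₚ.i≤suc[i] j) 1+j≤x))
                                 (j ℤ.≤? x) (ℤ.suc j ℤ.≤? x))

  atLeast-split : ∀ t j N → atLeast t j N ≡ count (isDiff t j) N + atLeast t (ℤ.suc j) N
  atLeast-split t j = count-+ (λ n → [j≤x]≡[x≡j]+[1+j≤x] j (δ t n))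

open Counting using (BoundedDifference⇒SameDensity; BoundedDifference-cancelʳ; atLeast-split; atLeast-rev-bounded)

corollary3p8 : (t : ℕ) → 1 ≤ t →
    ((j : ℤ) → SameDensity (isDiff t j) (isDiff (rev t) j))
    × SameDensity (isNonneg t) (isNonneg (rev t))
-- The argument works for every t.
corollary3p8 t _ =
  (λ j → BoundedDifference⇒SameDensity
           (BoundedDifference-cancelʳ (atLeast-split t j) (atLeast-split (rev t) j)
                                      (atLeast-rev-bounded t j) (atLeast-rev-bounded t (ℤ.suc j)))) ,
  BoundedDifference⇒SameDensity (atLeast-rev-bounded t ℤ.0ℤ)
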